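{- Let $k\ge 3$. The complete $k$-partite graph $K_{3*k}$, all of whose $k$ parts have size $3$, is strictly $k$-colorable.
   Context: Graphs are finite and simple. An integer partition $\lambda$ of a positive integer $k$ is a multiset of positive integers summing to $k$; $a*b$ denotes $b$ copies of $a$. A $k$-assignment $L$ of $G$ assigns to each vertex $v$ a set $L(v)$ of $k$ colors; $G$ is $L$-colorable if there is a proper coloring with each vertex $v$ receiving a color from $L(v)$. For an integer partition $\lambda=\{k_1,\dots,k_t\}$ of $k$, a $\lambda$-assignment of $G$ is a $k$-assignment $L$ such that $\bigcup_{v}L(v)$ can be partitioned into sets $C_1,\dots,C_t$ with $|L(v)\cap C_i|=k_i$ for every vertex $v$ and every $i$. $G$ is $\lambda$-choosable if $G$ is $L$-colorable for every $\lambda$-assignment $L$. (It is known that $G$ is $\{1*k\}$-choosable iff $G$ is $k$-colorable.) A graph $G$ is strictly $k$-colorable if $\{1*k\}$ is the only integer partition $\lambda$ of $k$ for which $G$ is $\lambda$-choosable, i.e. $G$ is $\{1*k\}$-choosable and not $\lambda$-choosable for any other partition $\lambda$ of $k$. -}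

module Defs where

open import Data.Nat using (ℕ; _≤_)
open import Data.Fin using (Fin; _≟_)
open import Data.List using (List; length; filter; lookup; replicate)
open import Data.Nat.ListAction using (sum)
open import Data.List.Relation.Unary.All using (All)
open import Data.List.Relation.Unary.Unique.Propositional using (Unique)
open import Data.List.Membership.Propositional using (_∈_)
open import Data.List.Relation.Binary.Permutation.Propositional using (_↭_)
open import Data.Product using (Σ; _×_; _,_)
open import Relation.Binary.PropositionalEquality using (_≡_; _≢_)
open import Relation.Nullary using (¬_)

-- A (finite, simple) graph is given by a vertex type V and an adjacency relation.
-- Colours are natural numbers (any finite colour set embeds into ℕ).

IsPartition : ℕ → List ℕ → Set
IsPartition k λs = All (λ x → 1 ≤ x) λs × sum λs ≡ k

IsKAssignment : {V : Set} → ℕ → (V → List ℕ) → Set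
IsKAssignment {V} k L = (v : V) → Unique (L v) × length (L v) ≡ k

-- a λ-assignment: a k-assignment together with a partition of the colours into
-- classes C_1..C_t (given by the class map `part`) with |L(v) ∩ C_i| = k_i.
IsLambdaAssignment : {V : Set} → (k : ℕ) → (λs : List ℕ) → (V → List ℕ) → Set
IsLambdaAssignment {V} k λs L =
  IsKAssignment k L ×
  Σ (ℕ → Fin (length λs)) (λ part →
    (v : V) (i : Fin (length λs)) →
      length (filter (λ c → part c ≟ i) (L v)) ≡ lookup λs i)

IsLColorable : {V : Set} → (V → V → Set) → (V → List ℕ) → Set
IsLColorable {V} Adj L =
  Σ (V → ℕ) (λ f → ((v : V) → f v ∈ L v) × ((u v : V) → Adj u v → f u ≢ f v))

IsLambdaChoosable : {V : Set} → (V → V → Set) → ℕ → List ℕ → Set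
IsLambdaChoosable {V} Adj k λs =
  (L : V → List ℕ) → IsLambdaAssignment k λs L → IsLColorable Adj L

IsStrictlyKColorable : {V : Set} → (V → V → Set) → ℕ → Set
IsStrictlyKColorable Adj k =
  IsLambdaChoosable Adj k (replicate k 1) ×
  ((λs : List ℕ) → IsPartition k λs → ¬ (λs ↭ replicate k 1) →
     ¬ IsLambdaChoosable Adj k λs)

K3Vertex : ℕ → Set
K3Vertex k = Fin k × Fin 3

K3Adj : (k : ℕ) → K3Vertex k → K3Vertex k → Set
K3Adj k (i , _) (j , _) = i ≢ j

-- A proper k-colouring c makes every {1*k}-assignment colourable: vertex v
-- takes the colour of its list lying in class c v.
--
-- If λ has a class i₀ of size at least 2, give vertex j of every part of
-- K_{3*k} the two colours of {0,1,2} other than j, all in class i₀, together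
-- with k − 2 colours shared by all vertices and spread over the classes so that
-- every list meets class i in λ_i colours.  A part avoiding the shared colours
-- gives vertex j a colour j′ ≠ j, a fixed-point-free map of {0,1,2}; two such
-- maps have intersecting images, so at most one part avoids the shared colours,
-- and the remaining k − 1 parts need distinct shared colours, of which there are
-- only k − 2.
module Submission where

open import Defs
open import Data.Nat using (ℕ; zero; suc; _+_; _≤_; _<_; _≥_; z≤n; s≤s)
open import Data.Nat.Properties using (+-identityʳ; +-cancelˡ-≡; <-irrefl; ≤-reflexive; ≤-trans; m≤m+n)
open import Data.Fin using (Fin; zero; suc; toℕ; cast)
open import Data.Fin.Properties using (_≟_; pigeonhole; <⇒≢; toℕ<n; cast-involutive; ∀-cons)
open import Data.Maybe using (fromMaybe)
open import Data.List using (List; []; _∷_; _++_; length; filter; lookup; replicate; map; applyUpTo; head; drop)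
open import Data.List.Properties using (length-++; length-map; length-replicate; lookup-replicate; length-applyUpTo; map-applyUpTo; filter-++)
open import Data.Nat.ListAction using (sum)
open import Data.List.Relation.Unary.All using (All; []; _∷_)
open import Data.List.Relation.Unary.Any using (here; there; index)
open import Data.List.Relation.Unary.Any.Properties using (lookup-index)
open import Data.List.Relation.Unary.AllPairs using ([]; _∷_)
open import Data.List.Relation.Unary.Unique.Propositional using (Unique)
open import Data.List.Relation.Unary.Unique.Propositional.Properties using (applyUpTo⁺₁; ++⁺)
open import Data.List.Membership.Propositional using (_∈_)
open import Data.List.Membership.Propositional.Properties using (∈-++⁻; ∈-filter⁻; ∈-applyUpTo⁻)
open import Data.List.Relation.Binary.Permutation.Propositional using (_↭_; ↭-refl; ↭-sym; ↭-trans)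
open import Data.List.Relation.Binary.Permutation.Propositional.Properties using (↭-length; filter-↭; ++⁺ˡ; shifts; map⁺)
open import Data.Product using (Σ; ∃; ∃₂; _×_; _,_; proj₁; proj₂)
open import Data.Sum using (_⊎_; inj₁; inj₂)
open import Data.Empty using (⊥-elim)
open import Function using (_∘_)
open import Relation.Nullary using (¬_; yes; no)
open import Relation.Unary using (Decidable)
open import Relation.Binary.PropositionalEquality
open ≡-Reasoning

filter-witness : ∀ {A : Set} {P : A → Set} (P? : Decidable P) (xs : List A) →
  0 < length (filter P? xs) → ∃ λ x → x ∈ xs × P x
filter-witness P? xs nonempty with filter P? xs in eq
filter-witness P? xs () | []
... | x ∷ _ = x , ∈-filter⁻ P? (subst (x ∈_) (sym eq) (here refl))

all⊎any : ∀ {n} {P Q : Fin n → Set} → (∀ i → P i ⊎ Q i) → (∀ i → P i) ⊎ ∃ Q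
all⊎any {zero} _ = inj₁ λ ()
all⊎any {suc n} h with h zero | all⊎any (h ∘ suc)
... | inj₂ q | _ = inj₂ (zero , q)
... | inj₁ _ | inj₂ (i , q) = inj₂ (suc i , q)
... | inj₁ p | inj₁ ps = inj₁ (∀-cons p ps)

count : ∀ {t} → Fin t → List (Fin t) → ℕ
count i = length ∘ filter (_≟ i)

count-map : ∀ {A : Set} {t} (g : A → Fin t) (i : Fin t) (xs : List A) →
  length (filter (λ x → g x ≟ i) xs) ≡ count i (map g xs)
count-map g i [] = refl
count-map g i (x ∷ xs) with g x ≟ i
... | yes _ = cong suc (count-map g i xs)
... | no _ = count-map g i xs

count-++ : ∀ {t} (i : Fin t) xs ys → count i (xs ++ ys) ≡ count i xs + count i ys
count-++ i xs ys = trans (cong length (filter-++ (_≟ i) xs ys)) (length-++ (filter (_≟ i) xs))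

count-↭ : ∀ {t} (i : Fin t) {xs ys} → xs ↭ ys → count i xs ≡ count i ys
count-↭ i = ↭-length ∘ filter-↭ (_≟ i)

FixedPointFree : ∀ {n} → (Fin n → Fin n) → Set
FixedPointFree g = ∀ j → g j ≢ j

-- With a = g 0 and b = h 0 the two nonzero points, g a ∈ {0, b} and h b ∈ {0, a}.
private
  images-meet-apart : (g h : Fin 3 → Fin 3) → FixedPointFree g → FixedPointFree h →
    g zero ≡ suc zero → h zero ≡ suc (suc zero) → ∃₂ λ a b → g a ≡ h b
  images-meet-apart g h g-fpf h-fpf g₀ h₀ with g (suc zero) in g₁
  ... | suc zero = ⊥-elim (g-fpf (suc zero) g₁)
  ... | suc (suc zero) = suc zero , zero , trans g₁ (sym h₀)
  ... | zero with h (suc (suc zero)) in h₂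
  ...   | zero = suc zero , suc (suc zero) , trans g₁ (sym h₂)
  ...   | suc zero = zero , suc (suc zero) , trans g₀ (sym h₂)
  ...   | suc (suc zero) = ⊥-elim (h-fpf (suc (suc zero)) h₂)

fixedPointFree-images-meet : (g h : Fin 3 → Fin 3) → FixedPointFree g → FixedPointFree h →
  ∃₂ λ a b → g a ≡ h b
fixedPointFree-images-meet g h g-fpf h-fpf with g zero in g₀ | h zero in h₀
... | zero | _ = ⊥-elim (g-fpf zero g₀)
... | _ | zero = ⊥-elim (h-fpf zero h₀)
... | suc zero | suc zero = zero , zero , trans g₀ (sym h₀)
... | suc (suc zero) | suc (suc zero) = zero , zero , trans g₀ (sym h₀)
... | suc zero | suc (suc zero) = images-meet-apart g h g-fpf h-fpf g₀ h₀
... | suc (suc zero) | suc zero with images-meet-apart h g h-fpf g-fpf h₀ g₀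
...   | a , b , hg = b , a , sym hg

colourable⇒ones-choosable : ∀ {V : Set} {Adj : V → V → Set} k (c : V → Fin k) →
  (∀ u v → Adj u v → c u ≢ c v) → IsLambdaChoosable Adj k (replicate k 1)
colourable⇒ones-choosable {V} {Adj} k c proper L (_ , part , counts) = colour , colour∈L , colour-proper
  where
  len : k ≡ length (replicate k 1)
  len = sym (length-replicate k)

  class : V → Fin (length (replicate k 1))
  class v = cast len (c v)

  pick : ∀ v → ∃ λ x → x ∈ L v × part x ≡ class v
  pick v = filter-witness (λ x → part x ≟ class v) (L v)
    (≤-reflexive (sym (trans (counts v (class v)) (lookup-replicate k 1 (c v)))))

  colour : V → ℕ
  colour = proj₁ ∘ pick

  colour∈L : ∀ v → colour v ∈ L v
  colour∈L = proj₁ ∘ proj₂ ∘ pick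

  class-injective : ∀ {u v} → class u ≡ class v → c u ≡ c v
  class-injective {u} {v} e = begin
    c u                           ≡⟨ sym (cast-involutive (sym len) len (c u)) ⟩
    cast (sym len) (class u)      ≡⟨ cong (cast (sym len)) e ⟩
    cast (sym len) (class v)      ≡⟨ cast-involutive (sym len) len (c v) ⟩
    c v                           ∎

  colour-proper : ∀ u v → Adj u v → colour u ≢ colour v
  colour-proper u v adj same = proper u v adj (class-injective (begin
    class u          ≡⟨ sym (proj₂ (proj₂ (pick u))) ⟩
    part (colour u)  ≡⟨ cong part same ⟩
    part (colour v)  ≡⟨ proj₂ (proj₂ (pick v)) ⟩
    class v          ∎))

ones-or-large : ∀ ns → All (λ n → 1 ≤ n) ns → ns ≡ replicate (length ns) 1 ⊎ ∃ λ i → 2 ≤ lookup ns i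
ones-or-large [] [] = inj₁ refl
ones-or-large (zero ∷ _) (() ∷ _)
ones-or-large (suc (suc _) ∷ _) _ = inj₂ (zero , s≤s (s≤s z≤n))
ones-or-large (suc zero ∷ ns) (_ ∷ pos) with ones-or-large ns pos
... | inj₁ e = inj₁ (cong (1 ∷_) e)
... | inj₂ (i , big) = inj₂ (suc i , big)

sum-replicate-1 : ∀ n → sum (replicate n 1) ≡ n
sum-replicate-1 zero = refl
sum-replicate-1 (suc n) = cong suc (sum-replicate-1 n)

partition-large-class : ∀ {k} ns → IsPartition k ns → ¬ (ns ↭ replicate k 1) → ∃ λ i → 2 ≤ lookup ns i
partition-large-class {k} ns (pos , sum≡k) not-ones with ones-or-large ns pos
... | inj₂ large = large
... | inj₁ ones = ⊥-elim (not-ones (subst (λ n → ns ↭ replicate n 1) length≡k (subst (ns ↭_) ones ↭-refl)))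
  where
  length≡k : length ns ≡ k
  length≡k = begin
    length ns                      ≡⟨ sym (sum-replicate-1 (length ns)) ⟩
    sum (replicate (length ns) 1)  ≡⟨ cong sum (sym ones) ⟩
    sum ns                         ≡⟨ sum≡k ⟩
    k                              ∎

classWord : (ns : List ℕ) → List (Fin (length ns))
classWord [] = []
classWord (n ∷ ns) = replicate n zero ++ map suc (classWord ns)

length-classWord : ∀ ns → length (classWord ns) ≡ sum ns
length-classWord [] = refl
length-classWord (n ∷ ns) = begin
  length (replicate n zero ++ map suc (classWord ns))     ≡⟨ length-++ (replicate n zero) ⟩
  length (replicate n zero) + length (map suc (classWord ns))
    ≡⟨ cong₂ _+_ (length-replicate n) (trans (length-map suc (classWord ns)) (length-classWord ns)) ⟩
  n + sum ns                                              ∎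

private
  count-replicate-zero : ∀ {t} n → count {suc t} zero (replicate n zero) ≡ n
  count-replicate-zero zero = refl
  count-replicate-zero (suc n) = cong suc (count-replicate-zero n)

  count-suc-replicate-zero : ∀ {t} n (j : Fin t) → count (suc j) (replicate n zero) ≡ 0
  count-suc-replicate-zero zero j = refl
  count-suc-replicate-zero (suc n) j = count-suc-replicate-zero n j

  count-zero-map-suc : ∀ {t} (xs : List (Fin t)) → count zero (map suc xs) ≡ 0
  count-zero-map-suc [] = refl
  count-zero-map-suc (x ∷ xs) = count-zero-map-suc xs

  count-suc-map-suc : ∀ {t} (j : Fin t) xs → count (suc j) (map suc xs) ≡ count j xs
  count-suc-map-suc j [] = refl
  count-suc-map-suc j (x ∷ xs) with x ≟ j
  ... | yes _ = cong suc (count-suc-map-suc j xs)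
  ... | no _ = count-suc-map-suc j xs

count-classWord : ∀ ns (i : Fin (length ns)) → count i (classWord ns) ≡ lookup ns i
count-classWord (n ∷ ns) zero = begin
  count zero (replicate n zero ++ map suc (classWord ns))
    ≡⟨ count-++ zero (replicate n zero) (map suc (classWord ns)) ⟩
  count zero (replicate n zero) + count zero (map suc (classWord ns))
    ≡⟨ cong₂ _+_ (count-replicate-zero n) (count-zero-map-suc (classWord ns)) ⟩
  n + 0
    ≡⟨ +-identityʳ n ⟩
  n ∎
count-classWord (n ∷ ns) (suc i) = begin
  count (suc i) (replicate n zero ++ map suc (classWord ns))
    ≡⟨ count-++ (suc i) (replicate n zero) (map suc (classWord ns)) ⟩
  count (suc i) (replicate n zero) + count (suc i) (map suc (classWord ns))
    ≡⟨ cong₂ _+_ (count-suc-replicate-zero n i) (count-suc-map-suc i (classWord ns)) ⟩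
  count i (classWord ns)
    ≡⟨ count-classWord ns i ⟩
  lookup ns i ∎

classWord-↭-twice : ∀ ns (i : Fin (length ns)) → 2 ≤ lookup ns i → ∃ λ w → classWord ns ↭ i ∷ i ∷ w
classWord-↭-twice (suc (suc m) ∷ ns) zero _ = replicate m zero ++ map suc (classWord ns) , ↭-refl
classWord-↭-twice (suc zero ∷ ns) zero (s≤s ())
classWord-↭-twice (n ∷ ns) (suc i) large with classWord-↭-twice ns i large
... | w , perm = replicate n zero ++ map suc w , ↭-trans
  (++⁺ˡ (replicate n zero) (map⁺ suc perm))
  (shifts (replicate n zero) (suc i ∷ suc i ∷ []))

otherTwo : Fin 3 → List ℕ
otherTwo zero = 1 ∷ 2 ∷ []
otherTwo (suc zero) = 0 ∷ 2 ∷ []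
otherTwo (suc (suc zero)) = 0 ∷ 1 ∷ []

∈-otherTwo⁻ : ∀ {x} j → x ∈ otherTwo j → ∃ λ c → c ≢ j × x ≡ toℕ c
∈-otherTwo⁻ zero (here refl) = suc zero , (λ ()) , refl
∈-otherTwo⁻ zero (there (here refl)) = suc (suc zero) , (λ ()) , refl
∈-otherTwo⁻ (suc zero) (here refl) = zero , (λ ()) , refl
∈-otherTwo⁻ (suc zero) (there (here refl)) = suc (suc zero) , (λ ()) , refl
∈-otherTwo⁻ (suc (suc zero)) (here refl) = zero , (λ ()) , refl
∈-otherTwo⁻ (suc (suc zero)) (there (here refl)) = suc zero , (λ ()) , refl

twoSpecialsAnd : ∀ {k} → List ℕ → K3Vertex k → List ℕ
twoSpecialsAnd S (_ , j) = otherTwo j ++ S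

module _ {k} (S : List ℕ) (f : K3Vertex k → ℕ) where

  data PartColours (p : Fin k) : Set where
    usesShared : (j : Fin 3) (r : Fin (length S)) → f (p , j) ≡ lookup S r → PartColours p
    avoidsShared : (g : Fin 3 → Fin 3) → FixedPointFree g → (∀ j → f (p , j) ≡ toℕ (g j)) → PartColours p

  slot : ∀ {p} → PartColours p → Fin (suc (length S))
  slot (usesShared _ r _) = suc r
  slot (avoidsShared _ _ _) = zero

  partColours : (∀ v → f v ∈ twoSpecialsAnd S v) → ∀ p → PartColours p
  partColours f∈L p with all⊎any (λ j → ∈-++⁻ (otherTwo j) (f∈L (p , j)))
  ... | inj₂ (j , f∈S) = usesShared j (index f∈S) (lookup-index f∈S)
  ... | inj₁ f∈otherTwo =
    avoidsShared (proj₁ ∘ otherColour) (proj₁ ∘ proj₂ ∘ otherColour) (proj₂ ∘ proj₂ ∘ otherColour)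
    where
    otherColour : ∀ j → ∃ λ c → c ≢ j × f (p , j) ≡ toℕ c
    otherColour j = ∈-otherTwo⁻ j (f∈otherTwo j)

  distinct-slots : (∀ u v → K3Adj k u v → f u ≢ f v) → ∀ {p q} → p ≢ q →
    (a : PartColours p) (b : PartColours q) → slot a ≢ slot b
  distinct-slots proper {p} {q} p≢q (usesShared j r fr) (usesShared j′ .r fr′) refl =
    proper (p , j) (q , j′) p≢q (trans fr (sym fr′))
  distinct-slots proper {p} {q} p≢q (avoidsShared g g-fpf fg) (avoidsShared h h-fpf fh) _
    with fixedPointFree-images-meet g h g-fpf h-fpf
  ... | a , b , ga≡hb = proper (p , a) (q , b) p≢q (trans (fg a) (trans (cong toℕ ga≡hb) (sym (fh b))))

twoSpecialsAnd-notColourable : ∀ {k} S → suc (length S) < k → ¬ IsLColorable (K3Adj k) (twoSpecialsAnd S)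
twoSpecialsAnd-notColourable S fewer (f , f∈L , proper)
  with pigeonhole fewer (slot S f ∘ partColours S f f∈L)
... | p , q , p<q , same = distinct-slots S f proper (<⇒≢ p<q) _ _ same

applyUpTo-lookupWithDefault : ∀ {A : Set} (d : A) xs →
  applyUpTo (λ m → fromMaybe d (head (drop m xs))) (length xs) ≡ xs
applyUpTo-lookupWithDefault d [] = refl
applyUpTo-lookupWithDefault d (x ∷ xs) = cong (x ∷_) (applyUpTo-lookupWithDefault d xs)

-- The special colours 0, 1, 2 lie in class i₀; colour 3 + m lies in class w[m].
module SharedColours {t} (i₀ : Fin t) (w : List (Fin t)) where

  shared : List ℕ
  shared = applyUpTo (3 +_) (length w)

  classOf : ℕ → Fin t
  classOf (suc (suc (suc m))) = fromMaybe i₀ (head (drop m w))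
  classOf _ = i₀

  classes-twoSpecialsAnd : ∀ j → map classOf (otherTwo j ++ shared) ≡ i₀ ∷ i₀ ∷ w
  classes-twoSpecialsAnd j = begin
    map classOf (otherTwo j ++ shared)                  ≡⟨ classes-otherTwo j ⟩
    i₀ ∷ i₀ ∷ map classOf shared                        ≡⟨ cong (λ ws → i₀ ∷ i₀ ∷ ws) (map-applyUpTo (3 +_) classOf (length w)) ⟩
    i₀ ∷ i₀ ∷ applyUpTo (classOf ∘ (3 +_)) (length w)   ≡⟨ cong (λ ws → i₀ ∷ i₀ ∷ ws) (applyUpTo-lookupWithDefault i₀ w) ⟩
    i₀ ∷ i₀ ∷ w                                         ∎
    where
    classes-otherTwo : ∀ j → map classOf (otherTwo j ++ shared) ≡ i₀ ∷ i₀ ∷ map classOf shared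
    classes-otherTwo zero = refl
    classes-otherTwo (suc zero) = refl
    classes-otherTwo (suc (suc zero)) = refl

  unique-twoSpecialsAnd : ∀ j → Unique (otherTwo j ++ shared)
  unique-twoSpecialsAnd j = ++⁺ (unique-otherTwo j) unique-shared apart
    where
    unique-otherTwo : ∀ j → Unique (otherTwo j)
    unique-otherTwo zero = ((λ ()) ∷ []) ∷ [] ∷ []
    unique-otherTwo (suc zero) = ((λ ()) ∷ []) ∷ [] ∷ []
    unique-otherTwo (suc (suc zero)) = ((λ ()) ∷ []) ∷ [] ∷ []

    unique-shared : Unique shared
    unique-shared = applyUpTo⁺₁ (3 +_) (length w) λ i<j _ eq → <-irrefl (+-cancelˡ-≡ 3 _ _ eq) i<j

    apart : ∀ {x} → ¬ (x ∈ otherTwo j × x ∈ shared)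
    apart (x∈otherTwo , x∈shared) with ∈-otherTwo⁻ j x∈otherTwo | ∈-applyUpTo⁻ (3 +_) x∈shared
    ... | c , _ , refl | m , _ , c≡3+m = <-irrefl c≡3+m (≤-trans (toℕ<n c) (m≤m+n 3 m))

twoSpecialsAnd-lambdaAssignment : ∀ {k} ns → sum ns ≡ k → (i₀ : Fin (length ns)) → 2 ≤ lookup ns i₀ →
  Σ (List ℕ) λ S → 2 + length S ≡ k × IsLambdaAssignment k ns (twoSpecialsAnd {k} S)
twoSpecialsAnd-lambdaAssignment {k} ns sum≡k i₀ large =
  shared , length-shared , kAssignment , classOf , counts
  where
  w : List (Fin (length ns))
  w = proj₁ (classWord-↭-twice ns i₀ large)

  perm : classWord ns ↭ i₀ ∷ i₀ ∷ w
  perm = proj₂ (classWord-↭-twice ns i₀ large)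

  open SharedColours i₀ w

  length-w : 2 + length w ≡ k
  length-w = begin
    2 + length w            ≡⟨ ↭-length (↭-sym perm) ⟩
    length (classWord ns)   ≡⟨ length-classWord ns ⟩
    sum ns                  ≡⟨ sum≡k ⟩
    k                       ∎

  length-shared : 2 + length shared ≡ k
  length-shared = trans (cong (2 +_) (length-applyUpTo (3 +_) (length w))) length-w

  kAssignment : IsKAssignment k (twoSpecialsAnd shared)
  kAssignment (_ , j) = unique-twoSpecialsAnd j , (begin
    length (otherTwo j ++ shared)                ≡⟨ sym (length-map classOf (otherTwo j ++ shared)) ⟩
    length (map classOf (otherTwo j ++ shared))  ≡⟨ cong length (classes-twoSpecialsAnd j) ⟩
    2 + length w                                 ≡⟨ length-w ⟩
    k                                            ∎)

  counts : ∀ v i → length (filter (λ c → classOf c ≟ i) (twoSpecialsAnd shared v)) ≡ lookup ns i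
  counts (_ , j) i = begin
    length (filter (λ c → classOf c ≟ i) (otherTwo j ++ shared))  ≡⟨ count-map classOf i (otherTwo j ++ shared) ⟩
    count i (map classOf (otherTwo j ++ shared))                   ≡⟨ cong (count i) (classes-twoSpecialsAnd j) ⟩
    count i (i₀ ∷ i₀ ∷ w)                                          ≡⟨ count-↭ i (↭-sym perm) ⟩
    count i (classWord ns)                                         ≡⟨ count-classWord ns i ⟩
    lookup ns i                                                    ∎

-- The hypothesis k ≥ 3 is unused: the argument works for every k.
mainTheorem2 : (k : ℕ) → k ≥ 3 → IsStrictlyKColorable (K3Adj k) k
mainTheorem2 k _ = colourable⇒ones-choosable k proj₁ (λ { (_ , _) (_ , _) p≢q → p≢q }) , notChoosable
  where
  notChoosable : ∀ ns → IsPartition k ns → ¬ (ns ↭ replicate k 1) → ¬ IsLambdaChoosable (K3Adj k) k ns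
  notChoosable ns partition@(_ , sum≡k) not-ones choosable
    with i₀ , large ← partition-large-class ns partition not-ones
    with S , length-S , assignment ← twoSpecialsAnd-lambdaAssignment ns sum≡k i₀ large
    = twoSpecialsAnd-notColourable S (≤-reflexive length-S) (choosable (twoSpecialsAnd {k} S) assignment)
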